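{- For every positive integer $n$, $$\sum_{k=1}^{n}\binom{\lfloor\frac{n-h_k}{2}\rfloor}{\lfloor\frac k2\rfloor}=(5+(-1)^n)\,2^{\lfloor\frac{n-3}{2}\rfloor}-1,$$ where $h_k\in\{0,1\}$ and $h_k\equiv k\pmod 2$.
   Context: The exponent $\lfloor\frac{n-3}{2}\rfloor$ may be negative, in which case the power of 2 is a rational number. -}

module Defs where

open import Data.Nat as ℕ using (ℕ; zero; suc)
open import Data.Integer as ℤ using (ℤ; +_; -[1+_])
open import Data.Integer.DivMod using (_/ℕ_)
open import Data.Rational as ℚ using (ℚ; 1ℚ)

two^ : ℤ → ℚ
two^ (+ m)      = ℤ.+ (2 ℕ.^ m) ℚ./ 1
two^ -[1+ m ]   = halfPow (suc m)
  where
  halfPow : ℕ → ℚ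
  halfPow zero    = 1ℚ
  halfPow (suc j) = ℚ.½ ℚ.* halfPow j

h : ℕ → ℕ
h k = k ℕ.% 2

neg1^ : ℕ → ℤ
neg1^ zero    = + 1
neg1^ (suc n) = ℤ.- neg1^ n

-- ⌊ (n - 3) / 2 ⌋ as an integer (floor division; may be negative)
e : ℕ → ℤ
e n = (+ n ℤ.- + 3) /ℕ 2

sum1 : ℕ → (ℕ → ℕ) → ℕ
sum1 zero    f = 0
sum1 (suc n) f = sum1 n f ℕ.+ f (suc n)

LHS : ℕ → ℕ
LHS n = sum1 n (λ k → ((n ℕ.∸ h k) ℕ./ 2) Data.Nat.Combinatorics.C (k ℕ./ 2))
  where import Data.Nat.Combinatorics

RHS : ℕ → ℚ
RHS n = (((+ 5 ℤ.+ neg1^ n) ℚ./ 1) ℚ.* two^ (e n)) ℚ.- 1ℚ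

-- Split the sum by the parity of k.  The odd indices k = 2j+1 contribute
-- C(⌊(n-1)/2⌋, j) and the even indices k = 2j+2 contribute C(⌊n/2⌋, j+1), so each
-- half is a partial row sum of Pascal's triangle: for n = 2t+1 the two halves are
-- 2^t and 2^t - 1, for n = 2t+2 they are 2^t and 2^(t+1) - 1.  Comparing with
-- (5 + (-1)^n) 2^⌊(n-3)/2⌋ - 1 is then arithmetic; n = 1, 2, where the exponent
-- is negative, are checked directly.
module Submission where

open import Defs
open import Data.Nat using (ℕ; _≥_)
open import Data.Integer using (+_)
open import Data.Rational using (_/_)
open import Relation.Binary.PropositionalEquality using (_≡_)

open import Function using (_∘_)
open import Data.Nat as ℕ using (zero; suc; _+_; _*_; _∸_; _^_; s≤s; z≤n)
open import Data.Nat.Properties using (+-suc; +-assoc; +-identityʳ; *-assoc; n<1+n)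
open import Data.Nat.DivMod using (m/n≡1+[m∸n]/n)
open import Data.Nat.Combinatorics using (_C_; k>n⇒nCk≡0; nCk+nC[k+1]≡[n+1]C[k+1])
open import Data.Nat.Tactic.RingSolver using (solve-∀)
import Data.Integer as ℤ
import Data.Integer.Properties as ℤ
import Data.Rational as ℚ
import Data.Rational.Properties as ℚ
import Data.Rational.Unnormalised as ℚᵘ
import Data.Rational.Unnormalised.Properties as ℚᵘ
open import Relation.Binary.PropositionalEquality
  using (refl; sym; trans; cong; cong₂; subst; module ≡-Reasoning)

∑< : ℕ → (ℕ → ℕ) → ℕ
∑< zero    f = 0
∑< (suc t) f = ∑< t f + f t

infixl 10 ∑<
syntax ∑< t (λ j → e) = ∑[ j < t ] e

∑<-cong : ∀ t {f g : ℕ → ℕ} → (∀ j → f j ≡ g j) → ∑< t f ≡ ∑< t g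
∑<-cong zero    f≗g = refl
∑<-cong (suc t) f≗g = cong₂ _+_ (∑<-cong t f≗g) (f≗g t)

∑<-distrib-+ : ∀ t (f g : ℕ → ℕ) → ∑[ j < t ] (f j + g j) ≡ ∑< t f + ∑< t g
∑<-distrib-+ zero    f g = refl
∑<-distrib-+ (suc t) f g =
  trans (cong (_+ (f t + g t)) (∑<-distrib-+ t f g)) (reorder (∑< t f) (∑< t g) (f t) (g t))
  where
  reorder : ∀ a b c d → (a + b) + (c + d) ≡ (a + c) + (b + d)
  reorder = solve-∀

∑<-unfoldˡ : ∀ t (f : ℕ → ℕ) → ∑< (suc t) f ≡ f 0 + ∑[ j < t ] f (suc j)
∑<-unfoldˡ zero    f = sym (+-identityʳ (f 0))
∑<-unfoldˡ (suc t) f = trans (cong (_+ f (suc t)) (∑<-unfoldˡ t f)) (+-assoc (f 0) _ _)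

sum1-double : ∀ t (f : ℕ → ℕ) →
              sum1 (t + t) f ≡ ∑[ j < t ] f (suc (j + j)) + ∑[ j < t ] f (2 + (j + j))
sum1-double zero    f = refl
sum1-double (suc t) f rewrite +-suc t t =
  trans (cong (λ s → s + f (suc (t + t)) + f (2 + (t + t))) (sum1-double t f))
        (reorder (∑[ j < t ] f (suc (j + j))) (∑[ j < t ] f (2 + (j + j))) _ _)
  where
  reorder : ∀ a b c d → ((a + b) + c) + d ≡ (a + c) + (b + d)
  reorder = solve-∀

∑-nCk≡2^n : ∀ n → ∑[ k < suc n ] (n C k) ≡ 2 ^ n
∑-nCk≡2^n zero    = refl
∑-nCk≡2^n (suc n) = begin
    ∑[ k < 2 + n ] (suc n C k)
  ≡⟨ ∑<-unfoldˡ (suc n) (suc n C_) ⟩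
    1 + ∑[ k < suc n ] (suc n C suc k)
  ≡⟨ cong (λ x → 1 + x) (∑<-cong (suc n) (λ k → sym (nCk+nC[k+1]≡[n+1]C[k+1] n k))) ⟩
    1 + ∑[ k < suc n ] (n C k + n C suc k)
  ≡⟨ cong (λ x → 1 + x) (∑<-distrib-+ (suc n) (n C_) (λ k → n C suc k)) ⟩
    1 + (S + (T + n C suc n))
  ≡⟨ cong (λ x → 1 + (S + (T + x))) (k>n⇒nCk≡0 (n<1+n n)) ⟩
    1 + (S + (T + 0))
  ≡⟨ reorder S T ⟩
    S + (1 + T)
  ≡⟨ cong₂ _+_ ih (trans (sym (∑<-unfoldˡ n (n C_))) ih) ⟩
    2 ^ n + 2 ^ n
  ≡⟨ cong (λ x → 2 ^ n + x) (+-identityʳ (2 ^ n)) ⟨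
    2 ^ suc n
  ∎
  where
  open ≡-Reasoning
  S = ∑[ k < suc n ] (n C k)
  T = ∑[ k < n ] (n C suc k)
  ih = ∑-nCk≡2^n n
  reorder : ∀ a b → 1 + (a + (b + 0)) ≡ a + (1 + b)
  reorder = solve-∀

1+∑-nC[1+k]≡2^n : ∀ n → 1 + ∑[ k < n ] (n C suc k) ≡ 2 ^ n
1+∑-nC[1+k]≡2^n n = trans (sym (∑<-unfoldˡ n (n C_))) (∑-nCk≡2^n n)

[2+n]/2≡1+n/2 : ∀ n → (2 + n) ℕ./ 2 ≡ suc (n ℕ./ 2)
[2+n]/2≡1+n/2 n = m/n≡1+[m∸n]/n {2 + n} (s≤s (s≤s z≤n))

[n+n]/2≡n : ∀ n → (n + n) ℕ./ 2 ≡ n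
[n+n]/2≡n zero    = refl
[n+n]/2≡n (suc n) rewrite +-suc n n = trans ([2+n]/2≡1+n/2 (n + n)) (cong suc ([n+n]/2≡n n))

[1+n+n]/2≡n : ∀ n → suc (n + n) ℕ./ 2 ≡ n
[1+n+n]/2≡n zero    = refl
[1+n+n]/2≡n (suc n) rewrite +-suc n n = trans ([2+n]/2≡1+n/2 (suc (n + n))) (cong suc ([1+n+n]/2≡n n))

h[n+n]≡0 : ∀ n → h (n + n) ≡ 0
h[n+n]≡0 zero    = refl
h[n+n]≡0 (suc n) rewrite +-suc n n = h[n+n]≡0 n

h[1+n+n]≡1 : ∀ n → h (suc (n + n)) ≡ 1
h[1+n+n]≡1 zero    = refl
h[1+n+n]≡1 (suc n) rewrite +-suc n n = h[1+n+n]≡1 n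

neg1^[n+n]≡1 : ∀ n → neg1^ (n + n) ≡ + 1
neg1^[n+n]≡1 zero    = refl
neg1^[n+n]≡1 (suc n) rewrite +-suc n n = trans (ℤ.neg-involutive (neg1^ (n + n))) (neg1^[n+n]≡1 n)

term : ℕ → ℕ → ℕ
term n k = ((n ∸ h k) ℕ./ 2) C (k ℕ./ 2)

term-odd : ∀ n j → term n (suc (j + j)) ≡ ((n ∸ 1) ℕ./ 2) C j
term-odd n j = cong₂ _C_ (cong (λ i → (n ∸ i) ℕ./ 2) (h[1+n+n]≡1 j)) ([1+n+n]/2≡n j)

term-even : ∀ n j → term n (2 + (j + j)) ≡ (n ℕ./ 2) C suc j
term-even n j = cong₂ _C_ (cong (λ i → (n ∸ i) ℕ./ 2) (h[n+n]≡0 j))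
                          (trans ([2+n]/2≡1+n/2 (j + j)) (cong suc ([n+n]/2≡n j)))

sum1-term-double : ∀ n t →
  sum1 (t + t) (term n) ≡ ∑[ j < t ] ((n ∸ 1) ℕ./ 2 C j) + ∑[ j < t ] ((n ℕ./ 2) C suc j)
sum1-term-double n t =
  trans (sum1-double t (term n)) (cong₂ _+_ (∑<-cong t (term-odd n)) (∑<-cong t (term-even n)))

LHS-odd : ∀ t → LHS (suc (t + t)) + 1 ≡ 2 ^ suc t
LHS-odd t = begin
    (sum1 (t + t) (term n) + term n n) + 1
  ≡⟨ cong₂ (λ s x → (s + x) + 1) (sum1-term-double n t) (term-odd n t) ⟩
    ((∑[ j < t ] ((t + t) ℕ./ 2 C j) + ∑[ j < t ] ((n ℕ./ 2) C suc j)) + ((t + t) ℕ./ 2) C t) + 1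
  ≡⟨ cong₂ (λ p q → ((∑[ j < t ] (p C j) + ∑[ j < t ] (q C suc j)) + p C t) + 1)
           ([n+n]/2≡n t) ([1+n+n]/2≡n t) ⟩
    ((∑[ j < t ] (t C j) + ∑[ j < t ] (t C suc j)) + t C t) + 1
  ≡⟨ reorder (∑[ j < t ] (t C j)) (∑[ j < t ] (t C suc j)) (t C t) ⟩
    (∑[ j < t ] (t C j) + t C t) + (1 + ∑[ j < t ] (t C suc j))
  ≡⟨ cong₂ _+_ (∑-nCk≡2^n t) (1+∑-nC[1+k]≡2^n t) ⟩
    2 ^ t + 2 ^ t
  ≡⟨ cong (λ x → 2 ^ t + x) (+-identityʳ (2 ^ t)) ⟨
    2 ^ suc t
  ∎
  where
  open ≡-Reasoning
  n = suc (t + t)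
  reorder : ∀ a b c → ((a + b) + c) + 1 ≡ (a + c) + (1 + b)
  reorder = solve-∀

LHS-even : ∀ t → LHS (suc t + suc t) + 1 ≡ 3 * 2 ^ t
LHS-even t = begin
    sum1 (t′ + t′) (term n) + 1
  ≡⟨ cong (_+ 1) (sum1-term-double n t′) ⟩
    (∑[ j < t′ ] ((t + t′) ℕ./ 2 C j) + ∑[ j < t′ ] ((n ℕ./ 2) C suc j)) + 1
  ≡⟨ cong₂ (λ p q → (∑[ j < t′ ] (p C j) + ∑[ j < t′ ] (q C suc j)) + 1)
           (trans (cong (ℕ._/ 2) (+-suc t t)) ([1+n+n]/2≡n t)) ([n+n]/2≡n t′) ⟩
    (∑[ j < t′ ] (t C j) + ∑[ j < t′ ] (t′ C suc j)) + 1
  ≡⟨ reorder (∑[ j < t′ ] (t C j)) (∑[ j < t′ ] (t′ C suc j)) ⟩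
    ∑[ j < t′ ] (t C j) + (1 + ∑[ j < t′ ] (t′ C suc j))
  ≡⟨ cong₂ _+_ (∑-nCk≡2^n t) (1+∑-nC[1+k]≡2^n t′) ⟩
    2 ^ t + 2 * 2 ^ t
  ≡⟨ w+2w≡3w (2 ^ t) ⟩
    3 * 2 ^ t
  ∎
  where
  open ≡-Reasoning
  t′ = suc t
  n = t′ + t′
  reorder : ∀ a b → (a + b) + 1 ≡ a + (1 + b)
  reorder = solve-∀
  w+2w≡3w : ∀ w → w + 2 * w ≡ 3 * w
  w+2w≡3w = solve-∀

fromℕ : ℕ → ℚ.ℚ
fromℕ n = + n / 1

toℚᵘ-fromℕ : ∀ n → ℚ.toℚᵘ (fromℕ n) ℚᵘ.≃ ℚᵘ.mkℚᵘ (+ n) 0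
toℚᵘ-fromℕ n = ℚ.toℚᵘ-fromℚᵘ (ℚᵘ.mkℚᵘ (+ n) 0)

fromℕ-homo-+ : ∀ m n → fromℕ (m + n) ≡ fromℕ m ℚ.+ fromℕ n
fromℕ-homo-+ m n = ℚ.toℚᵘ-injective (begin
    ℚ.toℚᵘ (fromℕ (m + n))                   ≈⟨ toℚᵘ-fromℕ (m + n) ⟩
    ℚᵘ.mkℚᵘ (+ (m + n)) 0                    ≈⟨ ℚᵘ.*≡* (cong (ℤ._* + 1) numerator) ⟩
    ℚᵘ.mkℚᵘ (+ m) 0 ℚᵘ.+ ℚᵘ.mkℚᵘ (+ n) 0      ≈⟨ ℚᵘ.+-cong (toℚᵘ-fromℕ m) (toℚᵘ-fromℕ n) ⟨
    ℚ.toℚᵘ (fromℕ m) ℚᵘ.+ ℚ.toℚᵘ (fromℕ n)   ≈⟨ ℚ.toℚᵘ-homo-+ (fromℕ m) (fromℕ n) ⟨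
    ℚ.toℚᵘ (fromℕ m ℚ.+ fromℕ n)             ∎)
  where
  open ℚᵘ.≃-Reasoning
  numerator : + (m + n) ≡ + m ℤ.* + 1 ℤ.+ + n ℤ.* + 1
  numerator = trans (ℤ.pos-+ m n) (sym (cong₂ ℤ._+_ (ℤ.*-identityʳ (+ m)) (ℤ.*-identityʳ (+ n))))

fromℕ-homo-* : ∀ m n → fromℕ (m * n) ≡ fromℕ m ℚ.* fromℕ n
fromℕ-homo-* m n = ℚ.toℚᵘ-injective (begin
    ℚ.toℚᵘ (fromℕ (m * n))                   ≈⟨ toℚᵘ-fromℕ (m * n) ⟩
    ℚᵘ.mkℚᵘ (+ (m * n)) 0                    ≈⟨ ℚᵘ.*≡* (cong (ℤ._* + 1) (ℤ.pos-* m n)) ⟩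
    ℚᵘ.mkℚᵘ (+ m) 0 ℚᵘ.* ℚᵘ.mkℚᵘ (+ n) 0      ≈⟨ ℚᵘ.*-cong (toℚᵘ-fromℕ m) (toℚᵘ-fromℕ n) ⟨
    ℚ.toℚᵘ (fromℕ m) ℚᵘ.* ℚ.toℚᵘ (fromℕ n)   ≈⟨ ℚ.toℚᵘ-homo-* (fromℕ m) (fromℕ n) ⟨
    ℚ.toℚᵘ (fromℕ m ℚ.* fromℕ n)             ∎)
  where open ℚᵘ.≃-Reasoning

+1≡*⇒fromℕ≡*-1 : ∀ {l} a b → l + 1 ≡ a * b → fromℕ l ≡ fromℕ a ℚ.* fromℕ b ℚ.- ℚ.1ℚ
+1≡*⇒fromℕ≡*-1 {l} a b eq = begin
    fromℕ l                             ≡⟨ ℚ.+-identityʳ (fromℕ l) ⟨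
    fromℕ l ℚ.+ ℚ.0ℚ                    ≡⟨ cong (fromℕ l ℚ.+_) (ℚ.+-inverseʳ ℚ.1ℚ) ⟨
    fromℕ l ℚ.+ (ℚ.1ℚ ℚ.- ℚ.1ℚ)         ≡⟨ ℚ.+-assoc (fromℕ l) ℚ.1ℚ (ℚ.- ℚ.1ℚ) ⟨
    (fromℕ l ℚ.+ ℚ.1ℚ) ℚ.- ℚ.1ℚ         ≡⟨ cong (ℚ._- ℚ.1ℚ) (fromℕ-homo-+ l 1) ⟨
    fromℕ (l + 1) ℚ.- ℚ.1ℚ              ≡⟨ cong (λ x → fromℕ x ℚ.- ℚ.1ℚ) eq ⟩
    fromℕ (a * b) ℚ.- ℚ.1ℚ              ≡⟨ cong (ℚ._- ℚ.1ℚ) (fromℕ-homo-* a b) ⟩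
    fromℕ a ℚ.* fromℕ b ℚ.- ℚ.1ℚ        ∎
  where open ≡-Reasoning

data ParityView : ℕ → Set where
  even : ∀ m → ParityView (m + m)
  odd  : ∀ m → ParityView (suc (m + m))

parityView : ∀ n → ParityView n
parityView zero = even zero
parityView (suc n) with parityView n
... | even m = odd m
... | odd m  = subst ParityView (cong suc (+-suc m m)) (even (suc m))

LHS[3+2m]+1≡4*2^m : ∀ m → LHS (3 + (m + m)) + 1 ≡ 4 * 2 ^ m
LHS[3+2m]+1≡4*2^m m = begin
    LHS (3 + (m + m)) + 1          ≡⟨ cong (λ n → LHS n + 1) (cong (suc ∘ suc) (+-suc m m)) ⟨
    LHS (suc (suc m + suc m)) + 1  ≡⟨ LHS-odd (suc m) ⟩
    2 * (2 * 2 ^ m)                ≡⟨ *-assoc 2 2 (2 ^ m) ⟨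
    4 * 2 ^ m                      ∎
  where open ≡-Reasoning

LHS[4+2m]+1≡6*2^m : ∀ m → LHS (4 + (m + m)) + 1 ≡ 6 * 2 ^ m
LHS[4+2m]+1≡6*2^m m = begin
    LHS (4 + (m + m)) + 1                    ≡⟨ cong (λ n → LHS n + 1) 4+2m≡2[2+m] ⟩
    LHS (suc (suc m) + suc (suc m)) + 1      ≡⟨ LHS-even (suc m) ⟩
    3 * (2 * 2 ^ m)                          ≡⟨ *-assoc 3 2 (2 ^ m) ⟨
    6 * 2 ^ m                                ∎
  where
  open ≡-Reasoning
  4+2m≡2[2+m] : 4 + (m + m) ≡ suc (suc m) + suc (suc m)
  4+2m≡2[2+m] = cong (suc ∘ suc) (sym (trans (+-suc m (suc m)) (cong suc (+-suc m m))))

-- By computation, e (3 + k) is + (k / 2) and neg1^ (3 + k) is - - - neg1^ k.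
RHS[3+2m]≡4*2^m-1 : ∀ m → RHS (3 + (m + m)) ≡ fromℕ 4 ℚ.* fromℕ (2 ^ m) ℚ.- ℚ.1ℚ
RHS[3+2m]≡4*2^m-1 m =
  cong₂ (λ s i → (+ 5 ℤ.+ s) / 1 ℚ.* two^ i ℚ.- ℚ.1ℚ)
        (cong (ℤ.-_ ∘ ℤ.-_ ∘ ℤ.-_) (neg1^[n+n]≡1 m)) (cong +_ ([n+n]/2≡n m))

RHS[4+2m]≡6*2^m-1 : ∀ m → RHS (4 + (m + m)) ≡ fromℕ 6 ℚ.* fromℕ (2 ^ m) ℚ.- ℚ.1ℚ
RHS[4+2m]≡6*2^m-1 m =
  cong₂ (λ s i → (+ 5 ℤ.+ s) / 1 ℚ.* two^ i ℚ.- ℚ.1ℚ)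
        (cong (ℤ.-_ ∘ ℤ.-_ ∘ ℤ.-_ ∘ ℤ.-_) (neg1^[n+n]≡1 m)) (cong +_ ([1+n+n]/2≡n m))

fromℕ-LHS[3+n]≡RHS[3+n] : ∀ {n} → ParityView n → fromℕ (LHS (3 + n)) ≡ RHS (3 + n)
fromℕ-LHS[3+n]≡RHS[3+n] (even m) =
  trans (+1≡*⇒fromℕ≡*-1 4 (2 ^ m) (LHS[3+2m]+1≡4*2^m m)) (sym (RHS[3+2m]≡4*2^m-1 m))
fromℕ-LHS[3+n]≡RHS[3+n] (odd m) =
  trans (+1≡*⇒fromℕ≡*-1 6 (2 ^ m) (LHS[4+2m]+1≡6*2^m m)) (sym (RHS[4+2m]≡6*2^m-1 m))

lemma1 : (n : ℕ) → n ≥ 1 → (+ LHS n) / 1 ≡ RHS n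
lemma1 zero ()
lemma1 1 _ = refl
lemma1 2 _ = refl
lemma1 (suc (suc (suc n))) _ = fromℕ-LHS[3+n]≡RHS[3+n] (parityView n)
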